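{- Let $p$ be a binary word of length $l$ having $r$ runs. For every $n \geq 0$, $$B_{n,p}(1) = \binom{n-r+1}{l-r+1}.$$
   Context: A binary word is a finite sequence $w = w_1 \cdots w_n$ with each $w_i \in \{0,1\}$; $n$ is its length. An occurrence of $p = p_1\cdots p_l$ in $w$ is a choice of indices $1 \le i_1 < \cdots < i_l \le n$ with $w_{i_1}\cdots w_{i_l} = p$. $c_p(w)$ is the number of occurrences of $p$ in $w$, and $B_{n,p}(k)$ is the number of binary words $w$ of length $n$ with $c_p(w)=k$. A run of $w$ is a maximal block of consecutive equal letters; its size is its length (e.g. $11100001$ has runs of sizes $3,4,1$). Binomial coefficients are combinatorial: $\binom{a}{b}$ is the number of $b$-element subsets of an $a$-element set, and is $0$ when $b > a$ or $a < 0$. -}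

module Defs where

open import Data.Nat using (ℕ; zero; suc; _+_)
open import Data.Bool using (Bool; true; false; _≟_)
open import Data.List using (List; []; _∷_; length; map; concatMap; filter)
open import Relation.Nullary using (yes; no)
open import Relation.Binary.PropositionalEquality using (_≡_)
import Data.Nat as ℕ

-- Binary words are lists of booleans (false = 0, true = 1).
Word : Set
Word = List Bool

-- c p w : number of occurrences of p in w as a (scattered) subsequence,
-- i.e. number of index tuples i₁ < ⋯ < i_l with w_{i₁}⋯w_{i_l} = p.
-- Standard recursion on w: an occurrence either does not use the first
-- letter of w, or uses it as the image of the first letter of p.
occ : Word → Word → ℕ
occ []      w        = 1
occ (a ∷ p) []       = 0
occ (a ∷ p) (b ∷ w) with a ≟ b
... | yes _ = occ (a ∷ p) w + occ p w
... | no  _ = occ (a ∷ p) w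

words : ℕ → List Word
words zero    = [] ∷ []
words (suc n) = concatMap (λ w → (false ∷ w) ∷ (true ∷ w) ∷ []) (words n)

B : ℕ → Word → ℕ → ℕ
B n p k = length (filter (λ w → occ p w ℕ.≟ k) (words n))

runsFrom : Bool → Word → ℕ
runsFrom a []      = 0
runsFrom a (b ∷ w) with a ≟ b
... | yes _ = runsFrom b w
... | no  _ = suc (runsFrom b w)

runs : Word → ℕ
runs []      = 0
runs (a ∷ w) = suc (runsFrom a w)

-- Let M n a p count the words of length n in which p occurs exactly once and a ∷ p
-- does not occur. Splitting on the first letter gives M (n+1) a (a ∷ q) =
-- M n a q + M n a (a ∷ q), M (n+1) (not c) (c ∷ q) = M n c q and M n a [] = 1: a
-- shifted Pascal recurrence, so M n a p = (n − r) choose d, where r and d count the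
-- letter changes and repetitions along a ∷ p. A word containing c ∷ q exactly once
-- cannot contain c ∷ c ∷ q, so B n (c ∷ q) 1 = M n c (c ∷ q).
module Submission where

open import Defs
open import Data.Nat using (ℕ; zero; suc; _+_; _∸_; _≤_; _≥_; s≤s; z≤n; s≤s⁻¹)
open import Data.Nat.Properties
  using (+-suc; +-comm; +-identityʳ; +-assoc; ≤-refl; ≤-reflexive; ≤-trans; m≤m+n;
         m+n≤o⇒m≤o; m+n≡0⇒m≡0; 0≢1+n; m+n≡0⇒n≡0; n≤0⇒n≡0; m+n∸m≡n)
open import Data.Nat.Combinatorics using (_C_; nCk+nC[k+1]≡[n+1]C[k+1]; k>n⇒nCk≡0)
open import Data.Bool using (Bool; true; false; not)
open import Data.List using ([]; _∷_; length; filter; concatMap)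
open import Data.List.Properties using (filter-≐; filter-none)
open import Data.List.Relation.Unary.All using (universal)
open import Data.Product using (_×_; _,_; proj₁)
open import Function using (_∘_)
open import Relation.Nullary using (¬_; does; yes; no)
open import Relation.Nullary.Decidable using (_×-dec_)
open import Relation.Unary using (Decidable; _≐_)
open import Relation.Binary.PropositionalEquality
  using (_≡_; refl; sym; trans; cong; cong₂; module ≡-Reasoning)
import Data.Bool as Bool
import Data.Nat as ℕ

open ≡-Reasoning

m+n≤1⇒m≡0 : ∀ {m n} → (n ≡ 0 → m ≡ 0) → m + n ≤ 1 → m ≡ 0
m+n≤1⇒m≡0 {n = zero}  n≡0⇒m≡0 _ = n≡0⇒m≡0 refl
m+n≤1⇒m≡0 {m} {suc n} _ m+n≤1 rewrite +-suc m n = m+n≡0⇒m≡0 m (n≤0⇒n≡0 (s≤s⁻¹ m+n≤1))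

occ-∷-same : ∀ c p w → occ (c ∷ p) (c ∷ w) ≡ occ (c ∷ p) w + occ p w
occ-∷-same false p w = refl
occ-∷-same true  p w = refl

occ-∷-not : ∀ c p w → occ (c ∷ p) (not c ∷ w) ≡ occ (c ∷ p) w
occ-∷-not false p w = refl
occ-∷-not true  p w = refl

occ-∷-≤ : ∀ p b w → occ p w ≤ occ p (b ∷ w)
occ-∷-≤ []      b w = ≤-refl
occ-∷-≤ (a ∷ p) b w with a Bool.≟ b
... | yes _ = m≤m+n (occ (a ∷ p) w) (occ p w)
... | no  _ = ≤-refl

occ-∷≡0⇒occ≡0 : ∀ p b w → occ p (b ∷ w) ≡ 0 → occ p w ≡ 0
occ-∷≡0⇒occ≡0 p b w eq = n≤0⇒n≡0 (≤-trans (occ-∷-≤ p b w) (≤-reflexive eq))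

occ-∷-≡0 : ∀ a p b w → occ (a ∷ p) w ≡ 0 → occ p w ≡ 0 → occ (a ∷ p) (b ∷ w) ≡ 0
occ-∷-≡0 a p b w ap≡0 p≡0 with a Bool.≟ b
... | yes _ = cong₂ _+_ ap≡0 p≡0
... | no  _ = ap≡0

occ≡0⇒occ∷≡0 : ∀ c p w → occ p w ≡ 0 → occ (c ∷ p) w ≡ 0
occ≡0⇒occ∷≡0 c p []      _    = refl
occ≡0⇒occ∷≡0 c p (b ∷ w) p≡0 =
  occ-∷-≡0 c p b w (occ≡0⇒occ∷≡0 c p w p≡0′) p≡0′
  where p≡0′ = occ-∷≡0⇒occ≡0 p b w p≡0

-- Either occurrence of c in an occurrence of c ∷ c ∷ p yields an occurrence of c ∷ p.
occ∷≤1⇒occ∷∷≡0 : ∀ c p w → occ (c ∷ p) w ≤ 1 → occ (c ∷ c ∷ p) w ≡ 0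
occ∷≤1⇒occ∷∷≡0 c p []      _  = refl
occ∷≤1⇒occ∷∷≡0 c p (b ∷ w) le with c Bool.≟ b
... | no  _ = occ∷≤1⇒occ∷∷≡0 c p w le
... | yes _ = cong₂ _+_ (occ∷≤1⇒occ∷∷≡0 c p w (m+n≤o⇒m≤o (occ (c ∷ p) w) le)) cp≡0
  where cp≡0 = m+n≤1⇒m≡0 (occ≡0⇒occ∷≡0 c p w) le

count : ∀ {P : Word → Set} → Decidable P → ℕ → ℕ
count P? n = length (filter P? (words n))

count-cong : ∀ {P Q : Word → Set} (P? : Decidable P) (Q? : Decidable Q) →
             P ≐ Q → ∀ n → count P? n ≡ count Q? n
count-cong P? Q? P≐Q n = cong length (filter-≐ P? Q? P≐Q (words n))

count-none : ∀ {P : Word → Set} (P? : Decidable P) → (∀ w → ¬ P w) → ∀ n → count P? n ≡ 0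
count-none P? ¬P n = cong length (filter-none P? (universal ¬P (words n)))

count-suc : ∀ {P : Word → Set} (P? : Decidable P) c n →
            count P? (suc n) ≡ count (P? ∘ (c ∷_)) n + count (P? ∘ (not c ∷_)) n
count-suc P? false n = split (words n)
  where
  split : ∀ ws → length (filter P? (concatMap (λ w → (false ∷ w) ∷ (true ∷ w) ∷ []) ws))
                 ≡ length (filter (P? ∘ (false ∷_)) ws) + length (filter (P? ∘ (true ∷_)) ws)
  split []       = refl
  split (w ∷ ws) with does (P? (false ∷ w))
  ... | false with does (P? (true ∷ w))
  ...   | false = split ws
  ...   | true  = trans (cong suc (split ws)) (sym (+-suc _ _))
  split (w ∷ ws) | true with does (P? (true ∷ w))
  ...   | false = cong suc (split ws)
  ...   | true  = cong suc (trans (cong suc (split ws)) (sym (+-suc _ _)))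
count-suc P? true n =
  trans (count-suc P? false n) (+-comm (count (P? ∘ (false ∷_)) n) (count (P? ∘ (true ∷_)) n))

-- The occurrence of p counted here is not preceded by any letter a.
OnceWithoutPrefix : Bool → Word → Word → Set
OnceWithoutPrefix a p w = occ p w ≡ 1 × occ (a ∷ p) w ≡ 0

onceWithoutPrefix? : ∀ a p → Decidable (OnceWithoutPrefix a p)
onceWithoutPrefix? a p w = occ p w ℕ.≟ 1 ×-dec occ (a ∷ p) w ℕ.≟ 0

#OnceWithoutPrefix : ℕ → Bool → Word → ℕ
#OnceWithoutPrefix n a p = count (onceWithoutPrefix? a p) n

once≐onceWithoutPrefix : ∀ c q → (λ w → occ (c ∷ q) w ≡ 1) ≐ OnceWithoutPrefix c (c ∷ q)
once≐onceWithoutPrefix c q =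
  (λ {w} once → once , occ∷≤1⇒occ∷∷≡0 c q w (≤-reflexive once)) , proj₁

onceWithoutPrefix-∷-same : ∀ a c q → OnceWithoutPrefix a (c ∷ q) ∘ (c ∷_) ≐ OnceWithoutPrefix c q
onceWithoutPrefix-∷-same a c q = to , from
  where
  to : ∀ {w} → OnceWithoutPrefix a (c ∷ q) (c ∷ w) → OnceWithoutPrefix c q w
  to {w} (once , _) = trans (cong (_+ occ q w) (sym cq≡0)) sum≡1 , cq≡0
    where
    sum≡1 = trans (sym (occ-∷-same c q w)) once
    cq≡0 = m+n≤1⇒m≡0 (occ≡0⇒occ∷≡0 c q w) (≤-reflexive sum≡1)
  from : ∀ {w} → OnceWithoutPrefix c q w → OnceWithoutPrefix a (c ∷ q) (c ∷ w)
  from {w} (q≡1 , cq≡0) =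
    trans (occ-∷-same c q w) (cong₂ _+_ cq≡0 q≡1) ,
    occ-∷-≡0 a (c ∷ q) c w (occ≡0⇒occ∷≡0 a (c ∷ q) w cq≡0) cq≡0

onceWithoutPrefix-∷-not : ∀ a p → (∀ w → occ p (not a ∷ w) ≡ occ p w) →
                          OnceWithoutPrefix a p ∘ (not a ∷_) ≐ OnceWithoutPrefix a p
onceWithoutPrefix-∷-not a p skip =
  (λ {w} (p≡1 , ap≡0) → trans (sym (skip w)) p≡1 , trans (sym (occ-∷-not a p w)) ap≡0) ,
  (λ {w} (p≡1 , ap≡0) → trans (skip w) p≡1 , trans (occ-∷-not a p w) ap≡0)

¬onceWithoutPrefix-∷ : ∀ a p → (∀ w → occ p (a ∷ w) ≡ occ p w) →
                       ∀ w → ¬ OnceWithoutPrefix a p (a ∷ w)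
¬onceWithoutPrefix-∷ a p skip w (p≡1 , ap≡0) = 0≢1+n (trans (sym p≡0) (trans (sym (skip w)) p≡1))
  where p≡0 = m+n≡0⇒n≡0 (occ (a ∷ p) w) (trans (sym (occ-∷-same a p w)) ap≡0)

#OnceWithoutPrefix-[] : ∀ n a → #OnceWithoutPrefix n a [] ≡ 1
#OnceWithoutPrefix-[] zero    a = refl
#OnceWithoutPrefix-[] (suc n) a = begin
  count P? (suc n)                                      ≡⟨ count-suc P? a n ⟩
  count (P? ∘ (a ∷_)) n + count (P? ∘ (not a ∷_)) n     ≡⟨ cong₂ _+_
    (count-none (P? ∘ (a ∷_)) (¬onceWithoutPrefix-∷ a [] (λ _ → refl)) n)
    (count-cong (P? ∘ (not a ∷_)) P? (onceWithoutPrefix-∷-not a [] (λ _ → refl)) n) ⟩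
  #OnceWithoutPrefix n a []                             ≡⟨ #OnceWithoutPrefix-[] n a ⟩
  1                                                     ∎
  where P? = onceWithoutPrefix? a []

#OnceWithoutPrefix-suc-same : ∀ n c q →
  #OnceWithoutPrefix (suc n) c (c ∷ q) ≡ #OnceWithoutPrefix n c q + #OnceWithoutPrefix n c (c ∷ q)
#OnceWithoutPrefix-suc-same n c q = trans (count-suc P? c n) (cong₂ _+_
  (count-cong (P? ∘ (c ∷_)) _ (onceWithoutPrefix-∷-same c c q) n)
  (count-cong (P? ∘ (not c ∷_)) P? (onceWithoutPrefix-∷-not c (c ∷ q) (occ-∷-not c q)) n))
  where P? = onceWithoutPrefix? c (c ∷ q)

#OnceWithoutPrefix-suc-not : ∀ n c q →
  #OnceWithoutPrefix (suc n) (not c) (c ∷ q) ≡ #OnceWithoutPrefix n c q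
#OnceWithoutPrefix-suc-not n c q = begin
  count P? (suc n)                                        ≡⟨ count-suc P? c n ⟩
  count (P? ∘ (c ∷_)) n + count (P? ∘ (not c ∷_)) n       ≡⟨ cong₂ _+_
    (count-cong (P? ∘ (c ∷_)) _ (onceWithoutPrefix-∷-same (not c) c q) n)
    (count-none (P? ∘ (not c ∷_)) (¬onceWithoutPrefix-∷ (not c) (c ∷ q) (occ-∷-not c q)) n) ⟩
  #OnceWithoutPrefix n c q + 0                            ≡⟨ +-identityʳ _ ⟩
  #OnceWithoutPrefix n c q                                ∎
  where P? = onceWithoutPrefix? (not c) (c ∷ q)

repeatsFrom : Bool → Word → ℕ
repeatsFrom a []      = 0
repeatsFrom a (b ∷ w) with a Bool.≟ b
... | yes _ = suc (repeatsFrom b w)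
... | no  _ = repeatsFrom b w

runsFrom+repeatsFrom≡length : ∀ a w → runsFrom a w + repeatsFrom a w ≡ length w
runsFrom+repeatsFrom≡length a []      = refl
runsFrom+repeatsFrom≡length a (b ∷ w) with a Bool.≟ b
... | yes _ = trans (+-suc (runsFrom b w) (repeatsFrom b w)) (cong suc (runsFrom+repeatsFrom≡length b w))
... | no  _ = cong suc (runsFrom+repeatsFrom≡length b w)

-- (n ∸ r) C d for r ≤ n, but 0 (rather than 0 C d) for n < r.
shiftedC : ℕ → ℕ → ℕ → ℕ
shiftedC n       zero    d = n C d
shiftedC zero    (suc r) d = 0
shiftedC (suc n) (suc r) d = shiftedC n r d

0C1+d≡0 : ∀ d → 0 C suc d ≡ 0
0C1+d≡0 d = k>n⇒nCk≡0 {0} {suc d} (s≤s z≤n)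

shiftedC-0-suc : ∀ r d → shiftedC 0 r (suc d) ≡ 0
shiftedC-0-suc zero    d = 0C1+d≡0 d
shiftedC-0-suc (suc r) d = refl

shiftedC-pascal : ∀ n r d → shiftedC n r d + shiftedC n r (suc d) ≡ shiftedC (suc n) r (suc d)
shiftedC-pascal n       zero    d = nCk+nC[k+1]≡[n+1]C[k+1] n d
shiftedC-pascal zero    (suc r) d = sym (shiftedC-0-suc r d)
shiftedC-pascal (suc n) (suc r) d = shiftedC-pascal n r d

shiftedC-suc : ∀ n r d → shiftedC n r (suc d) ≡ (n ∸ r) C suc d
shiftedC-suc n       zero    d = refl
shiftedC-suc zero    (suc r) d = sym (0C1+d≡0 d)
shiftedC-suc (suc n) (suc r) d = shiftedC-suc n r d

mutual
  #OnceWithoutPrefix≡shiftedC : ∀ n a p →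
    #OnceWithoutPrefix n a p ≡ shiftedC n (runsFrom a p) (repeatsFrom a p)
  #OnceWithoutPrefix≡shiftedC n a     []          = #OnceWithoutPrefix-[] n a
  #OnceWithoutPrefix≡shiftedC n false (false ∷ q) = #OnceWithoutPrefix-same≡shiftedC n false q
  #OnceWithoutPrefix≡shiftedC n true  (true ∷ q)  = #OnceWithoutPrefix-same≡shiftedC n true q
  #OnceWithoutPrefix≡shiftedC n false (true ∷ q)  = #OnceWithoutPrefix-not≡shiftedC n true q
  #OnceWithoutPrefix≡shiftedC n true  (false ∷ q) = #OnceWithoutPrefix-not≡shiftedC n false q

  #OnceWithoutPrefix-same≡shiftedC : ∀ n c q →
    #OnceWithoutPrefix n c (c ∷ q) ≡ shiftedC n (runsFrom c q) (suc (repeatsFrom c q))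
  #OnceWithoutPrefix-same≡shiftedC zero    c q = sym (shiftedC-0-suc (runsFrom c q) (repeatsFrom c q))
  #OnceWithoutPrefix-same≡shiftedC (suc n) c q = begin
    #OnceWithoutPrefix (suc n) c (c ∷ q)                         ≡⟨ #OnceWithoutPrefix-suc-same n c q ⟩
    #OnceWithoutPrefix n c q + #OnceWithoutPrefix n c (c ∷ q)    ≡⟨ cong₂ _+_
      (#OnceWithoutPrefix≡shiftedC n c q) (#OnceWithoutPrefix-same≡shiftedC n c q) ⟩
    shiftedC n r d + shiftedC n r (suc d)                        ≡⟨ shiftedC-pascal n r d ⟩
    shiftedC (suc n) r (suc d)                                   ∎
    where r = runsFrom c q; d = repeatsFrom c q

  #OnceWithoutPrefix-not≡shiftedC : ∀ n c q →
    #OnceWithoutPrefix n (not c) (c ∷ q) ≡ shiftedC n (suc (runsFrom c q)) (repeatsFrom c q)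
  #OnceWithoutPrefix-not≡shiftedC zero    c q = refl
  #OnceWithoutPrefix-not≡shiftedC (suc n) c q =
    trans (#OnceWithoutPrefix-suc-not n c q) (#OnceWithoutPrefix≡shiftedC n c q)

length+1∸runsFrom : ∀ c q → length q + 1 ∸ runsFrom c q ≡ suc (repeatsFrom c q)
length+1∸runsFrom c q = begin
  length q + 1 ∸ r         ≡⟨ cong (λ l → l + 1 ∸ r) (sym (runsFrom+repeatsFrom≡length c q)) ⟩
  r + d + 1 ∸ r            ≡⟨ cong (_∸ r) (+-assoc r d 1) ⟩
  r + (d + 1) ∸ r          ≡⟨ m+n∸m≡n r (d + 1) ⟩
  d + 1                    ≡⟨ +-comm d 1 ⟩
  suc d                    ∎
  where r = runsFrom c q; d = repeatsFrom c q

mainTheorem2 : (p : Word) → length p ≥ 1 → (n : ℕ) →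
    B n p 1 ≡ ((n + 1) ∸ runs p) C ((length p + 1) ∸ runs p)
mainTheorem2 []      () n
mainTheorem2 (c ∷ q) _  n = begin
  B n (c ∷ q) 1                          ≡⟨ count-cong _ (onceWithoutPrefix? c (c ∷ q)) (once≐onceWithoutPrefix c q) n ⟩
  #OnceWithoutPrefix n c (c ∷ q)         ≡⟨ #OnceWithoutPrefix-same≡shiftedC n c q ⟩
  shiftedC n r (suc d)                   ≡⟨ shiftedC-suc n r d ⟩
  (n ∸ r) C suc d                        ≡⟨ cong₂ _C_ (cong (_∸ suc r) (+-comm 1 n)) (sym (length+1∸runsFrom c q)) ⟩
  ((n + 1) ∸ suc r) C ((length q + 1) ∸ r) ∎
  where r = runsFrom c q; d = repeatsFrom c q
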